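{- For $n\ge1$ let $f_{n,i}$ be the coefficient of $x^i$ in $(1+x+x^2)^n$. Then for all sufficiently large $n$ of the form $n=3s-2$ with $s$ a positive integer, and all integers $k$ with $0<k<s-1$, \[ f_{n,2k-1}+2f_{n,2k}+\sum_{i=2k+1}^{\lfloor (n+k)/2\rfloor} f_{n,i}-f_{n,n-k}<0, \] where the sum is empty if $2k+1>\lfloor (n+k)/2\rfloor$.
   Context: $\lfloor x\rfloor$ denotes the integer part of $x$. -}

module Defs where

open import Data.Nat using (ℕ; zero; suc; _+_; _∸_; _/_)
open import Data.List using (List; []; _∷_; zipWith)
open import Data.Integer as ℤ using (ℤ; +_)

-- Polynomials with natural-number coefficients as coefficient lists
-- (lowest degree first).
Poly : Set
Poly = List ℕ

addP : Poly → Poly → Poly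
addP [] q = q
addP (a ∷ p) [] = a ∷ p
addP (a ∷ p) (b ∷ q) = (a + b) ∷ addP p q

shiftP : Poly → Poly
shiftP p = 0 ∷ p

mulTri : Poly → Poly
mulTri p = addP p (addP (shiftP p) (shiftP (shiftP p)))

triPow : ℕ → Poly
triPow zero = 1 ∷ []
triPow (suc n) = mulTri (triPow n)

coeff : Poly → ℕ → ℕ
coeff [] i = 0
coeff (a ∷ p) zero = a
coeff (a ∷ p) (suc i) = coeff p i

f : ℕ → ℕ → ℕ
f n i = coeff (triPow n) i

-- Σ_{i=a}^{b} g i  (empty, i.e. 0, when a > b)
sumFromTo : (ℕ → ℕ) → ℕ → ℕ → ℕ
sumFromTo g a b = go (suc b ∸ a) a
  where
  go : ℕ → ℕ → ℕ
  go zero i = 0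
  go (suc m) i = g i + go m (suc i)

lhs : ℕ → ℕ → ℤ
lhs n k =
  (+ (f n (2 * k ∸ 1) + 2 * f n (2 * k) + sumFromTo (f n) (2 * k + 1) ((n + k) / 2)))
  ℤ.- (+ f n (n ∸ k))
  where open import Data.Nat using (_*_)

{-# OPTIONS --safe #-}
-- Write f j for f n j. The coefficients satisfy j f j = (n − j + 1) f (j − 1) + (2n − j + 2) f (j − 2)
-- (by induction on n), and a two-step induction along j with this recurrence gives log-concavity.
-- Log-concavity places each ratio f (j + 1) / f j above the positive root of a quadratic, which yields
-- f (j + 1) ≥ f j below n and f (j + 1) ≥ (5/3) f j while 49 (j + 2) ≤ 33 (n + 1). For n = 3s − 2 ≥ 244
-- and k ≤ s − 2 every index up to M + 2, M = ⌊(n + k)/2⌋, lies in the second range, so the left-hand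
-- sum is dominated by a geometric series, at most 2.56 f M, whereas f (n − k) ≥ f (M + 2) ≥ (25/9) f M.
module Submission where

open import Defs
open import Data.Nat as ℕ using (ℕ; zero; suc; z≤n; s≤s)
import Data.Nat.Properties as ℕₚ
open import Data.Integer as ℤ using (ℤ; +_; 0ℤ)
import Data.Integer.Properties as ℤₚ
open import Data.List using ([]; _∷_)
open import Data.Product using (_,_; ∃-syntax)
open import Data.Sum using (inj₁; inj₂)
open import Relation.Binary.PropositionalEquality
open import Agda.Builtin.FromNat using (Number; fromNat)
open import Data.Unit using (tt)
import Data.Nat.Literals as ℕLiterals
import Data.Integer.Literals as ℤLiterals

instance
  ℕ-number : Number ℕ
  ℕ-number = ℕLiterals.number

  ℤ-number : Number ℤ
  ℤ-number = ℤLiterals.number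

coeff-addP : ∀ p q i → coeff (addP p q) i ≡ coeff p i ℕ.+ coeff q i
coeff-addP []      q       i       = refl
coeff-addP (a ∷ p) []      i       = sym (ℕₚ.+-identityʳ _)
coeff-addP (a ∷ p) (b ∷ q) zero    = refl
coeff-addP (a ∷ p) (b ∷ q) (suc i) = coeff-addP p q i

coeff-mulTri : ∀ p i →
  coeff (mulTri p) i ≡ coeff p i ℕ.+ (coeff (shiftP p) i ℕ.+ coeff (shiftP (shiftP p)) i)
coeff-mulTri p i = trans (coeff-addP p _ i) (cong (coeff p i ℕ.+_) (coeff-addP (shiftP p) (shiftP (shiftP p)) i))

f-zero : ∀ n → f n 0 ≡ 1
f-zero zero    = refl
f-zero (suc n) = trans (coeff-mulTri (triPow n) 0) (trans (ℕₚ.+-identityʳ _) (f-zero n))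

f-one : ∀ n → f n 1 ≡ n
f-one zero = refl
f-one (suc n) rewrite coeff-mulTri (triPow n) 1 | f-one n | f-zero n = ℕₚ.+-comm n 1

module _ where
  open import Data.Integer using (_+_; _*_; _-_; -_; _≤_; _<_; +≤+; +<+; -[1+_])
  open import Data.Integer.Tactic.RingSolver using (solve-∀)

  0≤+ : ∀ n → 0ℤ ≤ + n
  0≤+ n = +≤+ z≤n

  0≤-+ : ∀ {i j} → 0ℤ ≤ i → 0ℤ ≤ j → 0ℤ ≤ i + j
  0≤-+ = ℤₚ.+-mono-≤

  0≤-* : ∀ {i j} → 0ℤ ≤ i → 0ℤ ≤ j → 0ℤ ≤ i * j
  0≤-* {+ m} {+ n} _ _ = subst (0ℤ ≤_) (ℤₚ.pos-* m n) (0≤+ _)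

  0<-* : ∀ {i j} → 0ℤ < i → 0ℤ < j → 0ℤ < i * j
  0<-* {+ suc m} {+ suc n} _ _ = +<+ (s≤s z≤n)
  0<-* {+ zero} (+<+ ())
  0<-* {+ suc m} {+ zero} _ (+<+ ())

  0≤-cancel : ∀ {k x} → 0ℤ < k → 0ℤ ≤ k * x → 0ℤ ≤ x
  0≤-cancel {+ suc k} {+ x}       _ _  = 0≤+ x
  0≤-cancel {+ suc k} { -[1+ x ]} _ ()
  0≤-cancel {+ zero} (+<+ ())

  0≤-⇒≤0 : ∀ {x} → 0ℤ ≤ - x → x ≤ 0ℤ
  0≤-⇒≤0 {x} h = subst (_≤ 0ℤ) (ℤₚ.neg-involutive x) (ℤₚ.neg-mono-≤ h)

  ≤0⇒0≤- : ∀ {x} → x ≤ 0ℤ → 0ℤ ≤ - x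
  ≤0⇒0≤- = ℤₚ.neg-mono-≤

  drop-vanishing : ∀ {l r u v : ℤ} z → l ≡ r + (u - v) * z → u ≡ v → l ≡ r
  drop-vanishing {r = r} {u} z eq refl = begin
    _                ≡⟨ eq ⟩
    r + (u - u) * z  ≡⟨ cong (λ t → r + t * z) (ℤₚ.+-inverseʳ u) ⟩
    r + 0ℤ           ≡⟨ ℤₚ.+-identityʳ r ⟩
    r                ∎
    where open ≡-Reasoning

  -- F n j = f n (j − 2): the two leading zeros make the recurrence below hold at every index j.
  F : ℕ → ℕ → ℤ
  F n j = + coeff (shiftP (shiftP (triPow n))) j

  F-pascal : ∀ n j → F (suc n) (suc (suc j)) ≡ F n (suc (suc j)) + F n (suc j) + F n j
  F-pascal n j = begin
    + coeff (mulTri p) j               ≡⟨ cong +_ (coeff-mulTri p j) ⟩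
    + (x ℕ.+ (y ℕ.+ z))                ≡⟨ ℤₚ.pos-+ x (y ℕ.+ z) ⟩
    + x + + (y ℕ.+ z)                  ≡⟨ cong (λ t → + x + t) (ℤₚ.pos-+ y z) ⟩
    + x + (+ y + + z)                  ≡⟨ ℤₚ.+-assoc (+ x) (+ y) (+ z) ⟨
    + x + + y + + z                    ∎
    where
    open ≡-Reasoning
    p = triPow n
    x = coeff p j
    y = coeff (shiftP p) j
    z = coeff (shiftP (shiftP p)) j

  α β : ℤ → ℤ → ℤ
  α n j = n - j + 1
  β n j = 2 * n - j + 2

  recurrence-step : ∀ n j x₀ x₁ x₂ x₃ x₄ →
    j * x₂ ≡ α n j * x₁ + β n j * x₀ →
    (1 + j) * x₃ ≡ α n (1 + j) * x₂ + β n (1 + j) * x₁ →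
    (2 + j) * x₄ ≡ α n (2 + j) * x₃ + β n (2 + j) * x₂ →
    (2 + j) * (x₄ + x₃ + x₂) ≡ α (1 + n) (2 + j) * (x₃ + x₂ + x₁) + β (1 + n) (2 + j) * (x₂ + x₁ + x₀)
  recurrence-step n j x₀ x₁ x₂ x₃ x₄ e₀ e₁ e₂ = begin
      (2 + j) * (x₄ + x₃ + x₂)
    ≡⟨ expand j x₂ x₃ x₄ ⟩
      (2 + j) * x₄ + (1 + j) * x₃ + j * x₂ + (x₃ + 2 * x₂)
    ≡⟨ cong₂ _+_ (cong₂ _+_ (cong₂ _+_ e₂ e₁) e₀) refl ⟩
      (α n (2 + j) * x₃ + β n (2 + j) * x₂) + (α n (1 + j) * x₂ + β n (1 + j) * x₁)
        + (α n j * x₁ + β n j * x₀) + (x₃ + 2 * x₂)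
    ≡⟨ collect n j x₀ x₁ x₂ x₃ ⟩
      α (1 + n) (2 + j) * (x₃ + x₂ + x₁) + β (1 + n) (2 + j) * (x₂ + x₁ + x₀) ∎
    where
    open ≡-Reasoning
    expand : ∀ j x₂ x₃ x₄ →
      (2 + j) * (x₄ + x₃ + x₂) ≡ (2 + j) * x₄ + (1 + j) * x₃ + j * x₂ + (x₃ + 2 * x₂)
    expand = solve-∀
    collect : ∀ n j x₀ x₁ x₂ x₃ →
      ((n - (2 + j) + 1) * x₃ + (2 * n - (2 + j) + 2) * x₂) + ((n - (1 + j) + 1) * x₂ + (2 * n - (1 + j) + 2) * x₁)
        + ((n - j + 1) * x₁ + (2 * n - j + 2) * x₀) + (x₃ + 2 * x₂)
      ≡ ((1 + n) - (2 + j) + 1) * (x₃ + x₂ + x₁) + (2 * (1 + n) - (2 + j) + 2) * (x₂ + x₁ + x₀)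
    collect = solve-∀

  F-recurrence : ∀ n j → + j * F n (suc (suc j)) ≡ α (+ n) (+ j) * F n (suc j) + β (+ n) (+ j) * F n j
  F-recurrence n 0 = lhs-vanishes (α (+ n) 0) (β (+ n) 0) (F n 2)
    where
    lhs-vanishes : ∀ a b x → 0 * x ≡ a * 0 + b * 0
    lhs-vanishes = solve-∀
  F-recurrence n 1 rewrite f-one n | f-zero n = first (+ n)
    where
    first : ∀ n → 1 * n ≡ (n - 1 + 1) * 1 + (2 * n - 1 + 2) * 0
    first = solve-∀
  F-recurrence 0 2 = refl
  F-recurrence 0 (suc (suc (suc j))) = all-vanish (α 0 (+ (3 ℕ.+ j))) (β 0 (+ (3 ℕ.+ j))) (+ (3 ℕ.+ j))
    where
    all-vanish : ∀ a b c → c * 0 ≡ a * 0 + b * 0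
    all-vanish = solve-∀
  F-recurrence (suc n) (suc (suc j)) = begin
      + (2 ℕ.+ j) * F (suc n) (4 ℕ.+ j)
    ≡⟨ cong (+ (2 ℕ.+ j) *_) (F-pascal n (2 ℕ.+ j)) ⟩
      + (2 ℕ.+ j) * (F n (4 ℕ.+ j) + F n (3 ℕ.+ j) + F n (2 ℕ.+ j))
    ≡⟨ recurrence-step (+ n) (+ j) (F n j) (F n (1 ℕ.+ j)) (F n (2 ℕ.+ j)) (F n (3 ℕ.+ j)) (F n (4 ℕ.+ j))
                       (F-recurrence n j) (F-recurrence n (1 ℕ.+ j)) (F-recurrence n (2 ℕ.+ j)) ⟩
      α (+ suc n) (+ (2 ℕ.+ j)) * (F n (3 ℕ.+ j) + F n (2 ℕ.+ j) + F n (1 ℕ.+ j))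
        + β (+ suc n) (+ (2 ℕ.+ j)) * (F n (2 ℕ.+ j) + F n (1 ℕ.+ j) + F n j)
    ≡⟨ cong₂ (λ u v → α (+ suc n) (+ (2 ℕ.+ j)) * u + β (+ suc n) (+ (2 ℕ.+ j)) * v)
             (F-pascal n (suc j)) (F-pascal n j) ⟨
      α (+ suc n) (+ (2 ℕ.+ j)) * F (suc n) (3 ℕ.+ j) + β (+ suc n) (+ (2 ℕ.+ j)) * F (suc n) (2 ℕ.+ j) ∎
    where open ≡-Reasoning

  -- For J, b > 0 and x > 0, the sign of form J a b x y says on which side of the positive root
  -- of J t² − a t − b the ratio y / x lies.
  form : (J a b x y : ℤ) → ℤ
  form J a b x y = J * y * y - a * x * y - b * x * x

  form-flip : ∀ {J a b x y y′} → 0ℤ < J → 0ℤ ≤ b → J * y′ ≡ a * y + b * x →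
              0ℤ ≤ form J a b x y → form J a b y y′ ≤ 0ℤ
  form-flip {J} {a} {b} {x} {y} {y′} J>0 b≥0 rec xy≥0 =
    0≤-⇒≤0 (0≤-cancel J>0 (subst (0ℤ ≤_) (sym J*-form) (0≤-* b≥0 xy≥0)))
    where
    identity : ∀ J a b x y y′ →
      J * - (J * y′ * y′ - a * y * y′ - b * y * y)
        ≡ b * (J * y * y - a * x * y - b * x * x) + (a * y + b * x - J * y′) * (J * y′ + b * x)
    identity = solve-∀
    J*-form : J * - form J a b y y′ ≡ b * form J a b x y
    J*-form = drop-vanishing (J * y′ + b * x) (identity J a b x y y′) (sym rec)

  form-compare : ∀ {J a b x y p q} → 0ℤ ≤ J → 0ℤ < b → 0ℤ ≤ x → 0ℤ ≤ y → 0ℤ ≤ p → 0ℤ < q →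
                 0ℤ ≤ form J a b x y → form J a b q p ≤ 0ℤ → p * x ≤ q * y
  form-compare {x = + zero} {y} {p} {q} _ _ _ y≥0 _ q>0 _ _ =
    subst (_≤ q * y) (sym (ℤₚ.*-zeroʳ p)) (0≤-* (ℤₚ.<⇒≤ q>0) y≥0)
  form-compare {J} {a} {b} {x@(+ suc _)} {y} {p} {q} J≥0 b>0 x≥0 y≥0 p≥0 q>0 xy≥0 qp≤0 =
    ℤₚ.0≤i-j⇒j≤i (0≤-cancel K>0 (subst (0ℤ ≤_) (identity J a b x y p q)
      (0≤-+ (0≤-* (0≤-* p≥0 x≥0) (0≤-* (0≤-* q≥0 q≥0) xy≥0))
            (0≤-* (0≤-* q≥0 y≥0) (0≤-* (0≤-* x≥0 x≥0) (≤0⇒0≤- qp≤0))))))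
    where
    q≥0 = ℤₚ.<⇒≤ q>0
    qx>0 : 0ℤ < q * x
    qx>0 = 0<-* q>0 (+<+ (s≤s z≤n))
    K>0 : 0ℤ < J * (q * y) * (p * x) + b * ((q * x) * (q * x))
    K>0 = ℤₚ.+-mono-≤-< (0≤-* (0≤-* J≥0 (0≤-* q≥0 y≥0)) (0≤-* p≥0 x≥0)) (0<-* b>0 (0<-* qx>0 qx>0))
    identity : ∀ J a b x y p q →
      (p * x) * (q * q * (J * y * y - a * x * y - b * x * x))
        + (q * y) * (x * x * - (J * p * p - a * q * p - b * q * q))
      ≡ (J * (q * y) * (p * x) + b * ((q * x) * (q * x))) * (q * y - p * x)
    identity = solve-∀

  Q : (n J x y : ℤ) → ℤ
  Q n J = form J (α n J) (β n J)

  0≤n[n-1] : ∀ n → 0ℤ ≤ + n * (+ n - 1)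
  0≤n[n-1] zero    = 0≤+ 0
  0≤n[n-1] (suc n) = subst (0ℤ ≤_) (sym (shift (+ n))) (0≤-* (0≤+ (suc n)) (0≤+ n))
    where
    shift : ∀ m → (1 + m) * ((1 + m) - 1) ≡ (1 + m) * m
    shift = solve-∀

  -- After eliminating c by the recurrence, (1 + J)² Q n (2 + J) b c is a quadratic form in a, b whose
  -- only coefficient of indefinite sign is the one of b²; when it is negative, Q n J a b ≤ 0 bounds
  -- J b² by the other two monomials.
  advance : ∀ J U a b c → 1 ≤ J → 0ℤ ≤ U → 0ℤ ≤ U * (U - 1) → 0ℤ ≤ a → 0ℤ ≤ b →
            (1 + J) * c ≡ α (J + U) (1 + J) * b + β (J + U) (1 + J) * a →
            Q (J + U) J a b ≤ 0ℤ → 0ℤ ≤ Q (J + U) (2 + J) b c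
  advance J U a b c J≥1 U≥0 U[U-1]≥0 a≥0 b≥0 rec ab≤0 =
    0≤-cancel (0<-* J+1>0 J+1>0) (subst (0ℤ ≤_) (sym scaled) S≥0)
    where
    J>0 : 0ℤ < J
    J>0 = ℤₚ.<-≤-trans (+<+ (s≤s z≤n)) J≥1
    J≥0 = ℤₚ.<⇒≤ J>0
    J-1≥0 : 0ℤ ≤ J - 1
    J-1≥0 = ℤₚ.i≤j⇒0≤j-i J≥1
    J+1>0 : 0ℤ < 1 + J
    J+1>0 = ℤₚ.+-mono-<-≤ (+<+ (s≤s z≤n)) J≥0
    q = J + 2 * U + 1
    q≥0 : 0ℤ ≤ q
    q≥0 = 0≤-+ (0≤-+ J≥0 (0≤-* (0≤+ 2) U≥0)) (0≤+ 1)
    p = U * U - U - 3 * J * U - 2 * J * J * U - J * J * J - 2 * J * J - J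
    S = (2 + J) * q * q * (a * a) + q * (U * (J + 3) + J + 1) * (a * b) + p * (b * b)
    identity₁ : ∀ J U a b c →
      (1 + J) * (1 + J) * ((2 + J) * c * c - ((J + U) - (2 + J) + 1) * b * c - (2 * (J + U) - (2 + J) + 2) * b * b)
      ≡ (2 + J) * (J + 2 * U + 1) * (J + 2 * U + 1) * (a * a) + (J + 2 * U + 1) * (U * (J + 3) + J + 1) * (a * b)
        + (U * U - U - 3 * J * U - 2 * J * J * U - J * J * J - 2 * J * J - J) * (b * b)
        + ((1 + J) * c - (((J + U) - (1 + J) + 1) * b + (2 * (J + U) - (1 + J) + 2) * a))
          * ((2 + J) * ((1 + J) * c + ((J + U) - (1 + J) + 1) * b + (2 * (J + U) - (1 + J) + 2) * a)
             - (U - 1) * (1 + J) * b)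
    identity₁ = solve-∀
    identity₂ : ∀ J U a b →
      J * ((2 + J) * (J + 2 * U + 1) * (J + 2 * U + 1) * (a * a) + (J + 2 * U + 1) * (U * (J + 3) + J + 1) * (a * b)
           + (U * U - U - 3 * J * U - 2 * J * J * U - J * J * J - 2 * J * J - J) * (b * b))
      ≡ (2 * U * U * U + U * U + 2 * (U * (U - 1)) + U * (J - 1) * (3 * U + J)) * (a * a)
        + (U * (U * U + 3 * J * U + 2 * J * J + (J - 1))) * (a * b)
        + (- (U * U - U - 3 * J * U - 2 * J * J * U - J * J * J - 2 * J * J - J))
          * (- (J * b * b - ((J + U) - J + 1) * a * b - (2 * (J + U) - J + 2) * a * a))
    identity₂ = solve-∀
    scaled : (1 + J) * (1 + J) * Q (J + U) (2 + J) b c ≡ S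
    scaled = drop-vanishing _ (identity₁ J U a b c) rec
    S≥0 : 0ℤ ≤ S
    S≥0 with ℤₚ.≤-total 0ℤ p
    ... | inj₁ p≥0 =
      0≤-+ (0≤-+ (0≤-* (0≤-* (0≤-* (0≤-+ (0≤+ 2) J≥0) q≥0) q≥0) (0≤-* a≥0 a≥0))
                 (0≤-* (0≤-* q≥0 (0≤-+ (0≤-+ (0≤-* U≥0 (0≤-+ J≥0 (0≤+ 3))) J≥0) (0≤+ 1))) (0≤-* a≥0 b≥0)))
           (0≤-* p≥0 (0≤-* b≥0 b≥0))
    ... | inj₂ p≤0 = 0≤-cancel J>0 (subst (0ℤ ≤_) (sym (identity₂ J U a b))
      (0≤-+ (0≤-+ (0≤-* R₀≥0 (0≤-* a≥0 a≥0)) (0≤-* R₁≥0 (0≤-* a≥0 b≥0)))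
            (0≤-* (≤0⇒0≤- p≤0) (≤0⇒0≤- ab≤0))))
      where
      R₀≥0 : 0ℤ ≤ 2 * U * U * U + U * U + 2 * (U * (U - 1)) + U * (J - 1) * (3 * U + J)
      R₀≥0 = 0≤-+ (0≤-+ (0≤-+ (0≤-* (0≤-* (0≤-* (0≤+ 2) U≥0) U≥0) U≥0) (0≤-* U≥0 U≥0))
                        (0≤-* (0≤+ 2) U[U-1]≥0))
                  (0≤-* (0≤-* U≥0 J-1≥0) (0≤-+ (0≤-* (0≤+ 3) U≥0) J≥0))
      R₁≥0 : 0ℤ ≤ U * (U * U + 3 * J * U + 2 * J * J + (J - 1))
      R₁≥0 = 0≤-* U≥0 (0≤-+ (0≤-+ (0≤-+ (0≤-* U≥0 U≥0) (0≤-* (0≤-* (0≤+ 3) J≥0) U≥0))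
                                  (0≤-* (0≤-* (0≤+ 2) J≥0) J≥0)) J-1≥0)

  β-positive : ∀ {n j} → j ℕ.≤ suc n → 0ℤ < β (+ n) (+ j)
  β-positive {n} {j} h = subst (0ℤ <_) (sym (split (+ n) (+ j)))
    (ℤₚ.+-mono-≤-< (ℤₚ.i≤j⇒0≤j-i (+≤+ h)) (+<+ (s≤s z≤n)))
    where
    split : ∀ n j → 2 * n - j + 2 ≡ ((1 + n) - j) + (1 + n)
    split = solve-∀

  -- For j > 0 this is j (f n (j − 1)² − f n (j − 2) f n j) ≥ 0: log-concavity of f n at j − 1.
  LC : ℕ → ℕ → Set
  LC n j = 0ℤ ≤ Q (+ n) (+ j) (F n j) (F n (suc j))

  LC-one : ∀ n → LC n 1
  LC-one n = subst (0ℤ ≤_) (sym (square (α (+ n) 1) (β (+ n) 1) (F n 2)))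
    (0≤-* {F n 2} {F n 2} (0≤+ _) (0≤+ _))
    where
    square : ∀ a b y → 1 * y * y - a * 0 * y - b * 0 * 0 ≡ y * y
    square = solve-∀

  LC-two : ∀ n → LC n 2
  LC-two n = subst₂ (λ x y → 0ℤ ≤ Q (+ n) 2 (+ x) (+ y)) (sym (f-zero n)) (sym (f-one n))
    (subst (0ℤ ≤_) (sym (at-one-n (+ n))) (0≤n[n-1] n))
    where
    at-one-n : ∀ n → 2 * n * n - (n - 2 + 1) * 1 * n - (2 * n - 2 + 2) * 1 * 1 ≡ n * (n - 1)
    at-one-n = solve-∀

  LC-step : ∀ {n} i → suc i ℕ.≤ n → LC n (suc i) → LC n (3 ℕ.+ i)
  LC-step {n} i h lc with ℕₚ.m≤n⇒∃[o]m+o≡n h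
  ... | u , refl =
    advance (+ suc i) (+ u) (F n (2 ℕ.+ i)) (F n (3 ℕ.+ i)) (F n (4 ℕ.+ i))
      (+≤+ (s≤s z≤n)) (0≤+ u) (0≤n[n-1] u) (0≤+ _) (0≤+ _) (F-recurrence n (2 ℕ.+ i))
      (form-flip {+ suc i} {α (+ n) (+ suc i)} {β (+ n) (+ suc i)} {F n (suc i)} {F n (2 ℕ.+ i)} {F n (3 ℕ.+ i)}
                 (+<+ (s≤s z≤n)) (ℤₚ.<⇒≤ (β-positive (ℕₚ.m≤n⇒m≤1+n (ℕₚ.m≤m+n (suc i) u))))
                 (F-recurrence n (suc i)) lc)

  log-concave : ∀ {n} j → j ℕ.≤ n → LC n (2 ℕ.+ j)
  log-concave {n} 0             _ = LC-two n
  log-concave {n} 1             h = LC-step 0 h (LC-one n)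
  log-concave {n} (suc (suc j)) h = LC-step (suc j) h (log-concave {n} j (ℕₚ.≤-trans (ℕₚ.m≤n+m j 2) h))

  f-ratio : ∀ {n i} p q → suc i ℕ.≤ n → 0 ℕ.< q → Q (+ n) (+ (2 ℕ.+ i)) (+ q) (+ p) ≤ 0ℤ →
            p ℕ.* f n i ℕ.≤ q ℕ.* f n (suc i)
  f-ratio {n} {i} p q h q>0 qp≤0 =
    ℤₚ.drop‿+≤+ (subst₂ _≤_ (sym (ℤₚ.pos-* p (f n i))) (sym (ℤₚ.pos-* q (f n (suc i))))
      (form-compare {+ (2 ℕ.+ i)} {α (+ n) (+ (2 ℕ.+ i))} {β (+ n) (+ (2 ℕ.+ i))}
                    {F n (2 ℕ.+ i)} {F n (3 ℕ.+ i)} {+ p} {+ q} (0≤+ _) (β-positive (s≤s h)) (0≤+ _) (0≤+ _) (0≤+ p) (+<+ q>0)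
                    (log-concave i (ℕₚ.<⇒≤ h)) qp≤0))

  f-mono : ∀ {n i} → suc i ℕ.≤ n → f n i ℕ.≤ f n (suc i)
  f-mono {n} {i} h = subst₂ ℕ._≤_ (ℕₚ.*-identityˡ _) (ℕₚ.*-identityˡ _)
    (f-ratio 1 1 h (s≤s z≤n) (subst (_≤ 0ℤ) (sym (at-one-one (+ n) (+ i)))
      (ℤₚ.*-monoˡ-≤-nonNeg 3 (ℤₚ.i≤j⇒i-j≤0 (+≤+ h)))))
    where
    at-one-one : ∀ n i → (2 + i) * 1 * 1 - (n - (2 + i) + 1) * 1 * 1 - (2 * n - (2 + i) + 2) * 1 * 1
                         ≡ 3 * ((1 + i) - n)
    at-one-one = solve-∀

  f-grows : ∀ {n i} → 49 ℕ.* (2 ℕ.+ i) ℕ.≤ 33 ℕ.* (1 ℕ.+ n) → 5 ℕ.* f n i ℕ.≤ 3 ℕ.* f n (suc i)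
  f-grows {n} {i} h = f-ratio 5 3 i<n (s≤s z≤n) (subst (_≤ 0ℤ) (sym (at-five-three (+ n) (+ i)))
      (ℤₚ.i≤j⇒i-j≤0 (subst₂ _≤_ (ℤₚ.pos-* 49 (2 ℕ.+ i)) (ℤₚ.pos-* 33 (1 ℕ.+ n)) (+≤+ h))))
    where
    at-five-three : ∀ n i → (2 + i) * 5 * 5 - (n - (2 + i) + 1) * 3 * 5 - (2 * n - (2 + i) + 2) * 3 * 3
                            ≡ 49 * (2 + i) - 33 * (1 + n)
    at-five-three = solve-∀
    i<n : suc i ℕ.≤ n
    i<n = ℕₚ.≤-pred (ℕₚ.*-cancelˡ-≤ 49 (ℕₚ.≤-trans h (ℕₚ.*-monoˡ-≤ (1 ℕ.+ n) (ℕₚ.m≤m+n 33 16))))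

open import Data.Nat using (_+_; _*_; _∸_; _≤_; _<_; _≥_; _/_)
open import Data.Nat.DivMod using (m/n*n≤m; m*n/n≡m; /-monoˡ-≤)
open import Data.Nat.Tactic.RingSolver using (solve-∀)
open ℕₚ.≤-Reasoning

f-mono-≤ : ∀ {n i j} → i ≤ j → j ≤ n → f n i ≤ f n j
f-mono-≤ {j = zero}  z≤n _ = ℕₚ.≤-refl
f-mono-≤ {j = suc j} i≤j j<n with ℕₚ.m≤n⇒m<n∨m≡n i≤j
... | inj₁ i<j  = ℕₚ.≤-trans (f-mono-≤ (ℕₚ.≤-pred i<j) (ℕₚ.<⇒≤ j<n)) (f-mono j<n)
... | inj₂ refl = ℕₚ.≤-refl

f-positive : ∀ {n i} → i ≤ n → 0 < f n i
f-positive {n} {i} h = subst (_≤ f n i) (f-zero n) (f-mono-≤ z≤n h)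

two-steps : ∀ {x y z} → 5 * x ≤ 3 * y → 5 * y ≤ 3 * z → 25 * x ≤ 9 * z
two-steps {x} {y} {z} x≤y y≤z = begin
  25 * x       ≡⟨ ℕₚ.*-assoc 5 5 x ⟩
  5 * (5 * x)  ≤⟨ ℕₚ.*-monoʳ-≤ 5 x≤y ⟩
  5 * (3 * y)  ≡⟨ swap y ⟩
  3 * (5 * y)  ≤⟨ ℕₚ.*-monoʳ-≤ 3 y≤z ⟩
  3 * (3 * z)  ≡⟨ ℕₚ.*-assoc 3 3 z ⟨
  9 * z        ∎
  where
  swap : ∀ y → 5 * (3 * y) ≡ 3 * (5 * y)
  swap = solve-∀

sumFromTo-empty : ∀ g a → sumFromTo g (suc a) a ≡ 0
sumFromTo-empty g a with a ∸ a | ℕₚ.n∸n≡0 a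
... | .0 | refl = refl

sumFromTo-peel : ∀ g {a b} → a ≤ b → sumFromTo g a b ≡ g a + sumFromTo g (suc a) b
sumFromTo-peel g {a} {b} a≤b with suc b ∸ a | b ∸ a | ℕₚ.+-∸-assoc 1 a≤b
... | .(suc d) | d | refl = refl

sumFromTo-single : ∀ g a → sumFromTo g a a ≡ g a
sumFromTo-single g a = begin-equality
  sumFromTo g a a                  ≡⟨ sumFromTo-peel g ℕₚ.≤-refl ⟩
  g a + sumFromTo g (suc a) a      ≡⟨ cong (λ s → g a + s) (sumFromTo-empty g a) ⟩
  g a + 0                          ≡⟨ ℕₚ.+-identityʳ (g a) ⟩
  g a                              ∎

-- Exact for g i = (5/3)^i: then Σ_{c ≤ i ≤ M} g i = (3/2) (5/3 g M − g c).
geometric-sum : ∀ g {c M} → c ≤ M → (∀ i → c ≤ i → i < M → 5 * g i ≤ 3 * g (suc i)) →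
                2 * sumFromTo g c M + 3 * g c ≤ 5 * g M
geometric-sum g {c} c≤M grows with ℕₚ.m≤n⇒∃[o]m+o≡n c≤M
... | d , refl = subst (λ M → 2 * sumFromTo g c M + 3 * g c ≤ 5 * g M) (ℕₚ.+-comm d c)
                   (by-distance d c λ i c≤i i<M → grows i c≤i (subst (i <_) (ℕₚ.+-comm d c) i<M))
  where
  by-distance : ∀ d c → (∀ i → c ≤ i → i < d + c → 5 * g i ≤ 3 * g (suc i)) →
                2 * sumFromTo g c (d + c) + 3 * g c ≤ 5 * g (d + c)
  by-distance zero c _ = ℕₚ.≤-reflexive (begin-equality
    2 * sumFromTo g c c + 3 * g c  ≡⟨ cong (λ s → 2 * s + 3 * g c) (sumFromTo-single g c) ⟩
    2 * g c + 3 * g c              ≡⟨ ℕₚ.*-distribʳ-+ (g c) 2 3 ⟨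
    5 * g c                        ∎)
  by-distance (suc d) c grows = begin
    2 * sumFromTo g c (suc d + c) + 3 * g c
      ≡⟨ cong (λ s → 2 * s + 3 * g c) (sumFromTo-peel g (ℕₚ.m≤n+m c (suc d))) ⟩
    2 * (g c + S) + 3 * g c  ≡⟨ regroup (g c) S ⟩
    5 * g c + 2 * S          ≤⟨ ℕₚ.+-monoˡ-≤ (2 * S) (grows c ℕₚ.≤-refl (s≤s (ℕₚ.m≤n+m c d))) ⟩
    3 * g (suc c) + 2 * S    ≡⟨ ℕₚ.+-comm (3 * g (suc c)) (2 * S) ⟩
    2 * S + 3 * g (suc c)    ≤⟨ subst (λ M → 2 * sumFromTo g (suc c) M + 3 * g (suc c) ≤ 5 * g M)
                                      (ℕₚ.+-suc d c) (by-distance d (suc c) grows′) ⟩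
    5 * g (suc d + c)        ∎
    where
    S = sumFromTo g (suc c) (suc d + c)
    regroup : ∀ x s → 2 * (x + s) + 3 * x ≡ 5 * x + 2 * s
    regroup = solve-∀
    grows′ : ∀ i → suc c ≤ i → i < d + suc c → 5 * g i ≤ 3 * g (suc i)
    grows′ i c<i i<M = grows i (ℕₚ.<⇒≤ c<i) (subst (i <_) (ℕₚ.+-suc d c) i<M)

lhs-core : ∀ {n a M m} → 2 + a ≤ M → 2 + M ≤ m → m ≤ n → 49 * (3 + M) ≤ 33 * (1 + n) →
           f n a + 2 * f n (1 + a) + sumFromTo (f n) (2 + a) M < f n m
lhs-core {n} {a} {M} {m} a+2≤M M+2≤m m≤n ratio = ℕₚ.*-cancelˡ-< 1250 _ _ (begin-strict
  1250 * A              ≡⟨ ℕₚ.*-assoc 25 50 A ⟩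
  25 * (50 * A)         ≤⟨ ℕₚ.*-monoʳ-≤ 25 A-bound ⟩
  25 * (128 * g M)      ≡⟨ swap (g M) ⟩
  128 * (25 * g M)      ≤⟨ ℕₚ.*-monoʳ-≤ 128 (two-steps {g M} {g (1 + M)} {g (2 + M)}
                                              (grows M M<M+2) (grows (1 + M) ℕₚ.≤-refl)) ⟩
  128 * (9 * g (2 + M)) ≤⟨ ℕₚ.*-monoʳ-≤ 128 (ℕₚ.*-monoʳ-≤ 9 (f-mono-≤ M+2≤m m≤n)) ⟩
  128 * (9 * g m)       ≡⟨ ℕₚ.*-assoc 128 9 (g m) ⟨
  1152 * g m            <⟨ ℕₚ.*-monoˡ-< (g m) {{ℕ.>-nonZero (f-positive m≤n)}}
                                         (ℕₚ.m<m+n 1152 {98} (s≤s z≤n)) ⟩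
  1250 * g m            ∎)
  where
  g = f n
  S = sumFromTo g (2 + a) M
  A = g a + 2 * g (1 + a) + S
  M≤n : M ≤ n
  M≤n = ℕₚ.≤-trans (ℕₚ.≤-trans (ℕₚ.m≤n+m M 2) M+2≤m) m≤n
  M<M+2 : M < 2 + M
  M<M+2 = ℕₚ.n≤1+n (suc M)
  a+1<M+2 : 1 + a < 2 + M
  a+1<M+2 = ℕₚ.≤-trans a+2≤M (ℕₚ.m≤n+m M 2)
  a<M+2 : a < 2 + M
  a<M+2 = ℕₚ.≤-trans (ℕₚ.n≤1+n (suc a)) a+1<M+2
  grows : ∀ i → i < 2 + M → 5 * g i ≤ 3 * g (suc i)
  grows i i<M+2 = f-grows (ℕₚ.≤-trans (ℕₚ.*-monoʳ-≤ 49 (s≤s i<M+2)) ratio)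
  swap : ∀ y → 25 * (128 * y) ≡ 128 * (25 * y)
  swap = solve-∀
  A-bound : 50 * A ≤ 128 * g M
  A-bound = ℕₚ.+-cancelʳ-≤ (75 * x) (50 * A) (128 * g M) (begin
    50 * A + 75 * x
      ≡⟨ regroup (g a) (g (1 + a)) S x ⟩
    2 * (25 * g a) + 20 * (5 * g (1 + a)) + 25 * (2 * S + 3 * x)
      ≤⟨ ℕₚ.+-mono-≤ (ℕₚ.+-mono-≤ (ℕₚ.*-monoʳ-≤ 2 (two-steps {g a} {g (1 + a)} {g (2 + a)} (grows a a<M+2) (grows (1 + a) a+1<M+2)))
                                  (ℕₚ.*-monoʳ-≤ 20 (grows (1 + a) a+1<M+2)))
                     (ℕₚ.*-monoʳ-≤ 25 (geometric-sum g a+2≤M λ i _ i<M → grows i (ℕₚ.≤-trans i<M (ℕₚ.m≤n+m M 2)))) ⟩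
    2 * (9 * x) + 20 * (3 * x) + 25 * (5 * g M)
      ≡⟨ collect x (g M) ⟩
    3 * x + 125 * g M + 75 * x
      ≤⟨ ℕₚ.+-monoˡ-≤ (75 * x) (ℕₚ.+-monoˡ-≤ (125 * g M) (ℕₚ.*-monoʳ-≤ 3 (f-mono-≤ a+2≤M M≤n))) ⟩
    3 * g M + 125 * g M + 75 * x
      ≡⟨ cong (_+ 75 * x) (ℕₚ.*-distribʳ-+ (g M) 3 125) ⟨
    128 * g M + 75 * x  ∎)
    where
    x = g (2 + a)
    regroup : ∀ u v s x → 50 * (u + 2 * v + s) + 75 * x ≡ 2 * (25 * u) + 20 * (5 * v) + 25 * (2 * s + 3 * x)
    regroup = solve-∀
    collect : ∀ x y → 2 * (9 * x) + 20 * (3 * x) + 25 * (5 * y) ≡ 3 * x + 125 * y + 75 * x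
    collect = solve-∀

difference-negative : ∀ {x y} → x < y → + x ℤ.- + y ℤ.< 0ℤ
difference-negative {x} {y} x<y =
  subst (λ t → + x ℤ.- + y ℤ.< t) (ℤₚ.+-inverseʳ (+ y)) (ℤₚ.+-monoˡ-< (ℤ.- + y) (ℤ.+<+ x<y))

3k+4≤3s∸2 : ∀ {s k} → 0 < s → k < s ∸ 1 → 3 * k + 4 ≤ 3 * s ∸ 2
3k+4≤3s∸2 {suc s} {k} _ k<s = ℕₚ.m+n≤o⇒m≤o∸n (3 * k + 4) (begin
  3 * k + 4 + 2  ≡⟨ regroup k ⟩
  3 * (2 + k)    ≤⟨ ℕₚ.*-monoʳ-≤ 3 (s≤s k<s) ⟩
  3 * suc s      ∎)
  where
  regroup : ∀ k → 3 * k + 4 + 2 ≡ 3 * (2 + k)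
  regroup = solve-∀

lhs-negative : ∀ {n k} → 0 < k → 3 * k + 4 ≤ n → 244 ≤ n → lhs n k ℤ.< + 0
lhs-negative {n} {k@(suc _)} _ 3k+4≤n 244≤n =
  subst (λ t → + (f n a + 2 * f n (1 + a) + sumFromTo (f n) t M) ℤ.- + f n m ℤ.< + 0)
        (sym (ℕₚ.+-comm (2 * k) 1))
        (difference-negative (lhs-core a+2≤M M+2≤m (ℕₚ.m∸n≤m n k) ratio))
  where
  a = 2 * k ∸ 1
  M = (n + k) / 2
  m = n ∸ k
  2k+4+k≤n : 2 * k + 4 + k ≤ n
  2k+4+k≤n = subst (_≤ n) (regroup k) 3k+4≤n
    where
    regroup : ∀ k → 3 * k + 4 ≡ 2 * k + 4 + k
    regroup = solve-∀
  n≡m+k : n ≡ m + k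
  n≡m+k = sym (ℕₚ.m∸n+n≡m (ℕₚ.≤-trans (ℕₚ.m≤n+m k (2 * k + 4)) 2k+4+k≤n))
  a+2≤M : 2 + a ≤ M
  a+2≤M = begin
    2 + a                ≤⟨ ℕₚ.n≤1+n (1 + 2 * k) ⟩
    2 + 2 * k            ≡⟨ m*n/n≡m (2 + 2 * k) 2 ⟨
    (2 + 2 * k) * 2 / 2  ≤⟨ /-monoˡ-≤ 2 (subst (_≤ n + k) (regroup k) (ℕₚ.+-monoˡ-≤ k 3k+4≤n)) ⟩
    M                    ∎
    where
    regroup : ∀ k → 3 * k + 4 + k ≡ (2 + 2 * k) * 2
    regroup = solve-∀
  M+2≤m : 2 + M ≤ m
  M+2≤m = ℕₚ.*-cancelˡ-≤ 2 (begin
    2 * (2 + M)      ≡⟨ regroup M ⟩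
    4 + M * 2        ≤⟨ ℕₚ.+-monoʳ-≤ 4 (m/n*n≤m (n + k) 2) ⟩
    4 + (n + k)      ≡⟨ cong (λ t → 4 + (t + k)) n≡m+k ⟩
    4 + (m + k + k)  ≡⟨ regroup′ m k ⟩
    2 * k + 4 + m    ≤⟨ ℕₚ.+-monoˡ-≤ m (ℕₚ.m+n≤o⇒m≤o∸n (2 * k + 4) 2k+4+k≤n) ⟩
    m + m            ≡⟨ cong (λ t → m + t) (ℕₚ.+-identityʳ m) ⟨
    2 * m            ∎)
    where
    regroup : ∀ M → 2 * (2 + M) ≡ 4 + M * 2
    regroup = solve-∀
    regroup′ : ∀ m k → 4 + (m + k + k) ≡ 2 * k + 4 + m
    regroup′ = solve-∀
  -- Bounding 2 M ≤ n + k ≤ (4 n − 4) / 3 leaves exactly the condition n ≥ 244.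
  ratio : 49 * (3 + M) ≤ 33 * (1 + n)
  ratio = ℕₚ.*-cancelˡ-≤ 6 (begin
    6 * (49 * (3 + M))              ≡⟨ regroup M ⟩
    882 + 147 * (M * 2)             ≤⟨ ℕₚ.+-monoʳ-≤ 882 (ℕₚ.*-monoʳ-≤ 147 (m/n*n≤m (n + k) 2)) ⟩
    882 + 147 * (n + k)             ≡⟨ regroup′ n k ⟩
    686 + 147 * n + 49 * (3 * k + 4) ≤⟨ ℕₚ.+-monoʳ-≤ (686 + 147 * n) (ℕₚ.*-monoʳ-≤ 49 3k+4≤n) ⟩
    686 + 147 * n + 49 * n          ≡⟨ regroup″ n ⟩
    198 + 196 * n + 2 * 244         ≤⟨ ℕₚ.+-monoʳ-≤ (198 + 196 * n) (ℕₚ.*-monoʳ-≤ 2 244≤n) ⟩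
    198 + 196 * n + 2 * n           ≡⟨ regroup‴ n ⟩
    6 * (33 * (1 + n))              ∎)
    where
    regroup : ∀ M → 6 * (49 * (3 + M)) ≡ 882 + 147 * (M * 2)
    regroup = solve-∀
    regroup′ : ∀ n k → 882 + 147 * (n + k) ≡ 686 + 147 * n + 49 * (3 * k + 4)
    regroup′ = solve-∀
    regroup″ : ∀ n → 686 + 147 * n + 49 * n ≡ 198 + 196 * n + 2 * 244
    regroup″ = solve-∀
    regroup‴ : ∀ n → 198 + 196 * n + 2 * n ≡ 6 * (33 * (1 + n))
    regroup‴ = solve-∀

lemma3p8 : ∃[ N ] ∀ (s : ℕ) → 0 < s → 3 * s ∸ 2 ≥ N →
             ∀ (k : ℕ) → 0 < k → k < s ∸ 1 →
             lhs (3 * s ∸ 2) k ℤ.< + 0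
lemma3p8 = 244 , λ s s>0 n≥244 k k>0 k<s∸1 → lhs-negative k>0 (3k+4≤3s∸2 s>0 k<s∸1) n≥244
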